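{- Let $\ell\geq 1$ and let $a_0,\ldots,a_\ell,b_0,\ldots,b_\ell$ be elements of a differential field with $a_\ell\neq 0$. Define, for $0\leq i\leq\ell-1$, $\tilde b_i=b_i-\sum_{k=0}^{\ell-i}\binom{\ell}{\ell-i-k}a_{\ell-k}\left(\frac{b_\ell}{a_\ell}\right)^{(\ell-i-k)}$, and, assuming $\tilde b_{\ell-1}\neq 0$, define $\tilde a_0=a_0$ and for $1\leq i\leq\ell-1$ $\tilde a_i=a_i-\sum_{k=0}^{\ell-i}\binom{\ell-1}{\ell-i-k}\tilde b_{\ell-1-k}\left(\frac{a_\ell}{\tilde b_{\ell-1}}\right)^{(\ell-i-k)}$. Then the tuple $(b_i,a_i:0\leq i\leq\ell)$ is interdefinable with $(b_\ell,a_\ell,\tilde b_i,\tilde a_i:0\leq i\leq\ell-1)$.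
   Context: $y^{(r)}$ denotes the $r$-th derivative. Two tuples are interdefinable if each lies in the differential field generated (over $\mathbb{Q}$) by the other, i.e. each is definable from the other. -}

module Defs where

open import Level using (Level; _⊔_) renaming (suc to lsuc)
open import Algebra.Bundles using (CommutativeRing)
open import Data.Nat as ℕ using (ℕ; zero; suc; _∸_)
open import Data.Nat.Combinatorics using (_C_)
open import Data.List using (List; []; _∷_; map; upTo; _++_)
open import Data.List.Membership.Propositional using (_∈_)
open import Data.Product using (_×_)
open import Relation.Nullary using (¬_)

record DifferentialField (c ℓ : Level) : Set (lsuc (c ⊔ ℓ)) where
  field
    commutativeRing : CommutativeRing c ℓ
  open CommutativeRing commutativeRing public
  field
    1≉0    : ¬ (1# ≈ 0#)
    inv    : (x : Carrier) → ¬ (x ≈ 0#) → Carrier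
    inv-r  : (x : Carrier) (nz : ¬ (x ≈ 0#)) → x * inv x nz ≈ 1#
    ∂      : Carrier → Carrier
    ∂-cong : ∀ {x y} → x ≈ y → ∂ x ≈ ∂ y
    ∂-+    : ∀ x y → ∂ (x + y) ≈ ∂ x + ∂ y
    ∂-*    : ∀ x y → ∂ (x * y) ≈ ∂ x * y + x * ∂ y

module DF {c ℓ : Level} (K : DifferentialField c ℓ) where
  open DifferentialField K

  ∂^ : ℕ → Carrier → Carrier
  ∂^ zero x = x
  ∂^ (suc r) x = ∂ (∂^ r x)

  fromℕ : ℕ → Carrier
  fromℕ zero = 0#
  fromℕ (suc n) = 1# + fromℕ n

  Σ≤ : ℕ → (ℕ → Carrier) → Carrier
  Σ≤ zero f = f 0
  Σ≤ (suc n) f = Σ≤ n f + f (suc n)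

  div : Carrier → (y : Carrier) → ¬ (y ≈ 0#) → Carrier
  div x y nz = x * inv y nz

  -- Differential subfield generated (over the prime field) by a finite tuple:
  -- closed under 0, 1, +, -, *, inverses of nonzero elements, ∂, and ≈.
  data Gen (xs : List Carrier) : Carrier → Set (c ⊔ ℓ) where
    gen  : ∀ {x} → x ∈ xs → Gen xs x
    g0   : Gen xs 0#
    g1   : Gen xs 1#
    gadd : ∀ {x y} → Gen xs x → Gen xs y → Gen xs (x + y)
    gneg : ∀ {x} → Gen xs x → Gen xs (- x)
    gmul : ∀ {x y} → Gen xs x → Gen xs y → Gen xs (x * y)
    ginv : ∀ {x} (nz : ¬ (x ≈ 0#)) → Gen xs x → Gen xs (inv x nz)
    gder : ∀ {x} → Gen xs x → Gen xs (∂ x)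
    gcong : ∀ {x y} → x ≈ y → Gen xs x → Gen xs y

  Definable : List Carrier → List Carrier → Set (c ⊔ ℓ)
  Definable xs ys = ∀ {y} → y ∈ ys → Gen xs y

  Interdefinable : List Carrier → List Carrier → Set (c ⊔ ℓ)
  Interdefinable xs ys = Definable xs ys × Definable ys xs

  tup : ℕ → (ℕ → Carrier) → List Carrier
  tup n f = map f (upTo n)

  module Tilde (l : ℕ) (a b : ℕ → Carrier) (na : ¬ (a l ≈ 0#)) where
    bt : ℕ → Carrier
    bt i = b i - Σ≤ (l ∸ i) (λ k →
             fromℕ (l C (l ∸ i ∸ k)) * a (l ∸ k) * ∂^ (l ∸ i ∸ k) (div (b l) (a l) na))

    at : ¬ (bt (l ∸ 1) ≈ 0#) → ℕ → Carrier
    at nb zero = a 0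
    at nb i@(suc _) = a i - Σ≤ (l ∸ i) (λ k →
             fromℕ ((l ∸ 1) C (l ∸ i ∸ k)) * bt (l ∸ 1 ∸ k)
               * ∂^ (l ∸ i ∸ k) (div (a l) (bt (l ∸ 1)) nb))

{-# OPTIONS --safe #-}
-- The change of variables is triangular. Each b̃ᵢ differs from bᵢ by a differential
-- polynomial in the aⱼ, b_l and a_l⁻¹, and each ãᵢ differs from aᵢ by one in the b̃ⱼ,
-- a_l and b̃_{l-1}⁻¹. So from the original tuple one computes first the b̃ᵢ and then the
-- ãᵢ, and from the new tuple one recovers first the aᵢ and then the bᵢ.
module Submission where

open import Defs
open import Level using (Level)
open import Data.Nat using (ℕ; zero; suc; _≤_; _<_; _∸_; z≤n; s≤s; s≤s⁻¹)
open import Data.Nat.Properties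
  using (≤-refl; m≤n⇒m≤1+n; m∸n≤m; m≤n⇒m<n∨m≡n; ≤-<-trans; <⇒≤; ∸-monoʳ-<)
open import Data.Nat.Combinatorics using (_C_)
open import Data.List using (List; _∷_; _++_)
open import Data.List.Membership.Propositional using (_∈_)
open import Data.List.Membership.Propositional.Properties
  using (∈-map⁺; ∈-map⁻; ∈-++⁺ˡ; ∈-++⁺ʳ; ∈-++⁻; ∈-upTo⁺; ∈-upTo⁻)
open import Data.List.Relation.Unary.Any using (here; there)
open import Data.Product using (_,_)
open import Data.Sum using (inj₁; inj₂)
open import Relation.Binary.PropositionalEquality using (refl)
open import Relation.Nullary using (¬_)
open import Function.Bundles using (_⇔_; mk⇔; Equivalence)
open import Function.Construct.Identity using (⇔-id)

all≤-from-all< : ∀ {p} {P : ℕ → Set p} {n} →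
                 P n → (∀ i → i < n → P i) → ∀ i → i ≤ n → P i
all≤-from-all< Pn P< i i≤n with m≤n⇒m<n∨m≡n i≤n
... | inj₁ i<n  = P< i i<n
... | inj₂ refl = Pn

module GenProperties {c ℓ : Level} (K : DifferentialField c ℓ) where
  open DifferentialField K hiding (refl)
  open DF K
  open import Algebra.Properties.Group +-group using (//-rightDividesˡ)

  ∈-tup : ∀ {n i} (f : ℕ → Carrier) → i < n → f i ∈ tup n f
  ∈-tup f i<n = ∈-map⁺ f (∈-upTo⁺ i<n)

  module _ {xs : List Carrier} where

    Gen-fromℕ : ∀ n → Gen xs (fromℕ n)
    Gen-fromℕ zero    = g0
    Gen-fromℕ (suc n) = gadd g1 (Gen-fromℕ n)

    Gen-∂^ : ∀ r {x} → Gen xs x → Gen xs (∂^ r x)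
    Gen-∂^ zero    g = g
    Gen-∂^ (suc r) g = gder (Gen-∂^ r g)

    Gen-Σ≤ : ∀ n {f} → (∀ k → k ≤ n → Gen xs (f k)) → Gen xs (Σ≤ n f)
    Gen-Σ≤ zero    g = g 0 z≤n
    Gen-Σ≤ (suc n) g = gadd (Gen-Σ≤ n λ k k≤n → g k (m≤n⇒m≤1+n k≤n)) (g (suc n) ≤-refl)

    Gen-div : ∀ {x y} (y≉0 : ¬ (y ≈ 0#)) → Gen xs x → Gen xs y → Gen xs (div x y y≉0)
    Gen-div y≉0 gx gy = gmul gx (ginv y≉0 gy)

    Gen-⇔-- : ∀ {x y} → Gen xs y → Gen xs x ⇔ Gen xs (x - y)
    Gen-⇔-- {x} {y} gy = mk⇔ (λ gx → gadd gx (gneg gy))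
                             (λ gx-y → gcong (//-rightDividesˡ y x) (gadd gx-y gy))

    Gen-coefficient-∂^ : ∀ m r {u w} → Gen xs u → Gen xs w → Gen xs (fromℕ m * u * ∂^ r w)
    Gen-coefficient-∂^ m r gu gw = gmul (gmul (Gen-fromℕ m) gu) (Gen-∂^ r gw)

  Definable-∷ : ∀ {xs y ys} → Gen xs y → Definable xs ys → Definable xs (y ∷ ys)
  Definable-∷ gy dys (here refl) = gy
  Definable-∷ gy dys (there y∈) = dys y∈

  Definable-++ : ∀ {xs} ys {zs} → Definable xs ys → Definable xs zs → Definable xs (ys ++ zs)
  Definable-++ ys dys dzs y∈ with ∈-++⁻ ys y∈
  ... | inj₁ y∈ys = dys y∈ys
  ... | inj₂ y∈zs = dzs y∈zs

  Definable-tup : ∀ {xs} n {f} → (∀ i → i < n → Gen xs (f i)) → Definable xs (tup n f)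
  Definable-tup n {f} gf y∈ with ∈-map⁻ f y∈
  ... | i , i∈ , refl = gf i (∈-upTo⁻ i∈)

  module TildeGen (l : ℕ) (a b : ℕ → Carrier) (na : ¬ (a l ≈ 0#)) where
    open Tilde l a b na
    open Equivalence using (to; from)

    Gen-b⇔Gen-bt : ∀ {xs} → (∀ j → j ≤ l → Gen xs (a j)) → Gen xs (b l) →
                   ∀ i → Gen xs (b i) ⇔ Gen xs (bt i)
    Gen-b⇔Gen-bt Gen-a Gen-bₗ i = Gen-⇔-- (Gen-Σ≤ (l ∸ i) λ k _ →
      Gen-coefficient-∂^ (l C (l ∸ i ∸ k)) (l ∸ i ∸ k)
        (Gen-a (l ∸ k) (m∸n≤m l k)) (Gen-div na Gen-bₗ (Gen-a l ≤-refl)))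

    Gen-a⇔Gen-at : ∀ {xs} → 1 ≤ l → (nb : ¬ (bt (l ∸ 1) ≈ 0#)) →
                   Gen xs (a l) → (∀ j → j < l → Gen xs (bt j)) →
                   ∀ i → Gen xs (a i) ⇔ Gen xs (at nb i)
    Gen-a⇔Gen-at _   nb Gen-aₗ Gen-bt zero    = ⇔-id _
    Gen-a⇔Gen-at 1≤l nb Gen-aₗ Gen-bt (suc i) = Gen-⇔-- (Gen-Σ≤ (l ∸ suc i) λ k _ →
      Gen-coefficient-∂^ ((l ∸ 1) C (l ∸ suc i ∸ k)) (l ∸ suc i ∸ k)
        (Gen-bt (l ∸ 1 ∸ k) (≤-<-trans (m∸n≤m (l ∸ 1) k) l∸1<l))
        (Gen-div nb Gen-aₗ (Gen-bt (l ∸ 1) l∸1<l)))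
      where
      l∸1<l : l ∸ 1 < l
      l∸1<l = ∸-monoʳ-< (s≤s z≤n) 1≤l

    original : List Carrier
    original = tup (suc l) b ++ tup (suc l) a

    tilde : ¬ (bt (l ∸ 1) ≈ 0#) → List Carrier
    tilde nb = b l ∷ a l ∷ (tup l bt ++ tup l (at nb))

    original-defines-tilde : 1 ≤ l → (nb : ¬ (bt (l ∸ 1) ≈ 0#)) → Definable original (tilde nb)
    original-defines-tilde 1≤l nb = Definable-∷ (Gen-b l ≤-refl) (Definable-∷ (Gen-a l ≤-refl)
      (Definable-++ (tup l bt) (Definable-tup l Gen-bt) (Definable-tup l Gen-at)))
      where
      Gen-b : ∀ i → i ≤ l → Gen original (b i)
      Gen-b i i≤l = gen (∈-++⁺ˡ (∈-tup b (s≤s i≤l)))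
      Gen-a : ∀ i → i ≤ l → Gen original (a i)
      Gen-a i i≤l = gen (∈-++⁺ʳ (tup (suc l) b) (∈-tup a (s≤s i≤l)))
      Gen-bt : ∀ i → i < l → Gen original (bt i)
      Gen-bt i i<l = to (Gen-b⇔Gen-bt Gen-a (Gen-b l ≤-refl) i) (Gen-b i (<⇒≤ i<l))
      Gen-at : ∀ i → i < l → Gen original (at nb i)
      Gen-at i i<l = to (Gen-a⇔Gen-at 1≤l nb (Gen-a l ≤-refl) Gen-bt i) (Gen-a i (<⇒≤ i<l))

    tilde-defines-original : 1 ≤ l → (nb : ¬ (bt (l ∸ 1) ≈ 0#)) → Definable (tilde nb) original
    tilde-defines-original 1≤l nb = Definable-++ (tup (suc l) b)
      (Definable-tup (suc l) λ i i≤l → Gen-b i (s≤s⁻¹ i≤l))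
      (Definable-tup (suc l) λ i i≤l → Gen-a i (s≤s⁻¹ i≤l))
      where
      Gen-bₗ : Gen (tilde nb) (b l)
      Gen-bₗ = gen (here refl)
      Gen-aₗ : Gen (tilde nb) (a l)
      Gen-aₗ = gen (there (here refl))
      Gen-bt : ∀ i → i < l → Gen (tilde nb) (bt i)
      Gen-bt i i<l = gen (there (there (∈-++⁺ˡ (∈-tup bt i<l))))
      Gen-at : ∀ i → i < l → Gen (tilde nb) (at nb i)
      Gen-at i i<l = gen (there (there (∈-++⁺ʳ (tup l bt) (∈-tup (at nb) i<l))))
      Gen-a : ∀ i → i ≤ l → Gen (tilde nb) (a i)
      Gen-a = all≤-from-all< Gen-aₗ λ i i<l → from (Gen-a⇔Gen-at 1≤l nb Gen-aₗ Gen-bt i) (Gen-at i i<l)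
      Gen-b : ∀ i → i ≤ l → Gen (tilde nb) (b i)
      Gen-b = all≤-from-all< Gen-bₗ λ i i<l → from (Gen-b⇔Gen-bt Gen-a Gen-bₗ i) (Gen-bt i i<l)

lemma4p5 : {c ℓ' : Level} (K : DifferentialField c ℓ') →
    let open DifferentialField K in
    let open DF K in
    (l : ℕ) → 1 ≤ l → (a b : ℕ → Carrier) →
    (na : ¬ (a l ≈ 0#)) →
    (nb : ¬ (Tilde.bt l a b na (l ∸ 1) ≈ 0#)) →
    Interdefinable
      (tup (suc l) b ++ tup (suc l) a)
      (b l ∷ a l ∷ (tup l (Tilde.bt l a b na) ++ tup l (Tilde.at l a b na nb)))
lemma4p5 K l 1≤l a b na nb =
  original-defines-tilde 1≤l nb , tilde-defines-original 1≤l nb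
  where open GenProperties.TildeGen K l a b na
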